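{- For any finite simple graph $G=(V,E)$ and any positive integer $k$ with $|V|\ge \gamma(G)+k$, $Sb_k(G)\ge k$.
   Context: $\gamma(G)$ is the domination number of $G$ (minimum size of a dominating set). For a positive integer $k$, $Sb_k(G)$ is the minimum size of a set $\mathcal{E}\subseteq E$ such that $\gamma(G-\mathcal{E})=\gamma(G)+k$. -}

module Defs where

open import Data.Bool using (Bool; true; false; _∧_; not; _∨_)
open import Data.Nat using (ℕ)
open import Data.Fin using (Fin; _<_; _≟_)
open import Data.Fin.Subset using (Subset; _∈_; ∣_∣)
open import Data.Product using (_×_; _,_; ∃; ∃-syntax)
open import Data.Sum using (_⊎_)
open import Data.List using (List; length)
open import Data.Bool.ListAction using (any)
open import Data.List.Relation.Unary.All using (All)
open import Data.List.Relation.Unary.Unique.Propositional using (Unique)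
open import Relation.Nullary.Decidable using (⌊_⌋)
open import Relation.Binary.PropositionalEquality using (_≡_; cong; cong₂)
open import Data.Bool.Properties using (∨-comm)

record Graph (n : ℕ) : Set where
  field
    adj   : Fin n → Fin n → Bool
    sym   : ∀ u v → adj u v ≡ adj v u
    irrefl : ∀ v → adj v v ≡ false
open Graph public

IsDominating : ∀ {n} → Graph n → Subset n → Set
IsDominating {n} G D = ∀ (v : Fin n) → v ∈ D ⊎ (∃[ u ] (u ∈ D × adj G u v ≡ true))

IsDominationNumber : ∀ {n} → Graph n → ℕ → Set
IsDominationNumber G g =
  (∃[ D ] (IsDominating G D × ∣ D ∣ ≡ g)) ×
  (∀ D → IsDominating G D → g Data.Nat.≤ ∣ D ∣)

-- A set of edges of G: a duplicate-free list of pairs (u , v) with u < v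
-- (each unordered edge {u,v} is represented exactly once) and uv ∈ E(G).
-- Its size is the length of the list.
IsEdgeSet : ∀ {n} → Graph n → List (Fin n × Fin n) → Set
IsEdgeSet G F =
  Unique F × All (λ { (u , v) → (u < v) × adj G u v ≡ true }) F

occurs₁ : ∀ {n} → List (Fin n × Fin n) → Fin n → Fin n → Bool
occurs₁ F u v = any (λ { (a , b) → ⌊ a ≟ u ⌋ ∧ ⌊ b ≟ v ⌋ }) F

occurs : ∀ {n} → List (Fin n × Fin n) → Fin n → Fin n → Bool
occurs F u v = occurs₁ F u v ∨ occurs₁ F v u

delete : ∀ {n} → Graph n → List (Fin n × Fin n) → Graph n
delete G F = record
  { adj = λ u v → adj G u v ∧ not (occurs F u v)
  ; sym = λ u v → cong₂ (λ x y → x ∧ not y) (Graph.sym G u v) (∨-comm (occurs₁ F u v) (occurs₁ F v u))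
  ; irrefl = λ v → cong (λ x → x ∧ not (occurs F v v)) (Graph.irrefl G v)
  }

-- Deleting one edge ab raises the domination number by at most one: if D
-- dominates, then D ∪ {b} still does when a ∈ D, and D ∪ {a} does otherwise.
-- Hence γ(G - F) ≤ γ(G) + |F|, which is the lower bound. Deleting the edges of
-- G one at a time, γ climbs in steps of at most one from γ(G) to γ of the
-- edgeless graph, which is n ≥ γ(G) + k, so it takes the value γ(G) + k.
module Submission where

open import Defs hiding (sym)
open import Data.Bool using (true; false; _∧_; _∨_)
import Data.Bool as Bool
open import Data.Bool.Properties using (∧-identityʳ; ∨-zeroʳ)
open import Data.Fin using (Fin; _≟_)
import Data.Fin.Properties as Fin
open import Data.Fin.Subset using (Subset; ∣_∣; _∈_; _∪_; ⁅_⁆; ⊤; _⊆_; inside; outside)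
open import Data.Fin.Subset.Properties
  using (_∈?_; anySubset?; ∈⊤; ∣⊤∣≡n; ∣⁅x⁆∣≡1; p⊆q⇒∣p∣≤∣q∣; x∈⁅x⁆; x∈p∪q⁺)
open import Data.List using (List; []; _∷_; length; drop; filter; cartesianProduct; allFin)
open import Data.List.Membership.Propositional using () renaming (_∈_ to _∈ₗ_)
open import Data.List.Membership.Propositional.Properties using (∈-filter⁺; ∈-cartesianProduct⁺; ∈-allFin)
open import Data.List.Relation.Unary.Any using (here; there)
import Data.List.Relation.Unary.All as All
import Data.List.Relation.Unary.All.Properties as All
import Data.List.Relation.Unary.Unique.Propositional.Properties as Unique
open import Data.Nat using (ℕ; suc; _+_; _≤_; _<_; z≤n; s≤s; _<?_; s≤s⁻¹)
open import Data.Nat.Induction using (<-wellFounded)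
open import Data.Nat.Properties
  using (≤-refl; ≤-reflexive; ≤-trans; ≤-antisym; ≮⇒≥; ≤∧≢⇒<; m≤n⇒m≤1+n; module ≤-Reasoning;
         +-comm; +-suc; +-identityʳ; +-monoʳ-≤; +-cancelˡ-≤)
open import Data.Product using (_×_; _,_; proj₁; proj₂; ∃; ∃-syntax)
open import Data.Sum using (_⊎_; inj₁; inj₂)
open import Data.Vec using (_∷_; [])
open import Induction.WellFounded using (Acc; acc)
open import Relation.Binary using (tri<; tri≈; tri>)
open import Relation.Binary.PropositionalEquality using (_≡_; refl; sym; trans; cong; subst; subst₂; ≢-sym)
open import Relation.Nullary using (Dec; yes; no; contradiction)
open import Relation.Nullary.Decidable using (_×-dec_; _⊎-dec_; ⌊_⌋)

private
  variable
    n : ℕ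

∣p∪q∣≤∣p∣+∣q∣ : (p q : Subset n) → ∣ p ∪ q ∣ ≤ ∣ p ∣ + ∣ q ∣
∣p∪q∣≤∣p∣+∣q∣ []            []            = z≤n
∣p∪q∣≤∣p∣+∣q∣ (inside ∷ p)  (inside ∷ q)  =
  s≤s (≤-trans (∣p∪q∣≤∣p∣+∣q∣ p q) (+-monoʳ-≤ ∣ p ∣ (m≤n⇒m≤1+n ≤-refl)))
∣p∪q∣≤∣p∣+∣q∣ (inside ∷ p)  (outside ∷ q) = s≤s (∣p∪q∣≤∣p∣+∣q∣ p q)
∣p∪q∣≤∣p∣+∣q∣ (outside ∷ p) (inside ∷ q)  =
  subst (suc ∣ p ∪ q ∣ ≤_) (sym (+-suc ∣ p ∣ ∣ q ∣)) (s≤s (∣p∪q∣≤∣p∣+∣q∣ p q))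
∣p∪q∣≤∣p∣+∣q∣ (outside ∷ p) (outside ∷ q) = ∣p∪q∣≤∣p∣+∣q∣ p q

∣p∪⁅x⁆∣≤1+∣p∣ : (p : Subset n) (x : Fin n) → ∣ p ∪ ⁅ x ⁆ ∣ ≤ suc ∣ p ∣
∣p∪⁅x⁆∣≤1+∣p∣ p x = subst (∣ p ∪ ⁅ x ⁆ ∣ ≤_) (trans (cong (∣ p ∣ +_) (∣⁅x⁆∣≡1 x)) (+-comm ∣ p ∣ 1))
                            (∣p∪q∣≤∣p∣+∣q∣ p ⁅ x ⁆)

dominating? : (H : Graph n) (D : Subset n) → Dec (IsDominating H D)
dominating? H D =
  Fin.all? λ v → (v ∈? D) ⊎-dec Fin.any? λ u → (u ∈? D) ×-dec (adj H u v Bool.≟ true)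

domination-number-exists : (H : Graph n) → ∃ (IsDominationNumber H)
domination-number-exists {n} H = shrink ⊤ (λ _ → inj₁ ∈⊤) (<-wellFounded ∣ ⊤ {n} ∣)
  where
  shrink : ∀ D → IsDominating H D → Acc _<_ ∣ D ∣ → ∃ (IsDominationNumber H)
  shrink D d (acc smaller) with anySubset? (λ D′ → dominating? H D′ ×-dec (∣ D′ ∣ <? ∣ D ∣))
  ... | yes (D′ , d′ , lt) = shrink D′ d′ (smaller lt)
  ... | no none            = ∣ D ∣ , (D , d , refl) , λ D′ d′ → ≮⇒≥ λ lt → none (D′ , d′ , lt)

γ[_] : Graph n → ℕ
γ[ H ] = proj₁ (domination-number-exists H)

γ-isDominationNumber : (H : Graph n) → IsDominationNumber H γ[ H ]
γ-isDominationNumber H = proj₂ (domination-number-exists H)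

γ-minimal : (H : Graph n) {D : Subset n} → IsDominating H D → γ[ H ] ≤ ∣ D ∣
γ-minimal H = proj₂ (γ-isDominationNumber H) _

IsDominationNumber⇒≡γ : (H : Graph n) {g : ℕ} → IsDominationNumber H g → g ≡ γ[ H ]
IsDominationNumber⇒≡γ H ((D , d , refl) , minimal) with γ-isDominationNumber H
... | (D′ , d′ , ∣D′∣≡γ) , _ = ≤-antisym (≤-trans (minimal D′ d′) (≤-reflexive ∣D′∣≡γ)) (γ-minimal H d)

IsDominating-transfer : (H H′ : Graph n) {D D′ : Subset n} → D ⊆ D′ →
  (∀ {u v} → u ∈ D → adj H u v ≡ true → adj H′ u v ≡ true ⊎ v ∈ D′) →
  IsDominating H D → IsDominating H′ D′
IsDominating-transfer H H′ D⊆D′ covered d v with d v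
... | inj₁ v∈D = inj₁ (D⊆D′ v∈D)
... | inj₂ (u , u∈D , uv) with covered u∈D uv
...   | inj₁ uv′  = inj₂ (u , D⊆D′ u∈D , uv′)
...   | inj₂ v∈D′ = inj₁ v∈D′

γ-antimono : (H H′ : Graph n) → (∀ {u v} → adj H u v ≡ true → adj H′ u v ≡ true) → γ[ H′ ] ≤ γ[ H ]
γ-antimono H H′ H⊆H′ with γ-isDominationNumber H
... | (D , d , ∣D∣≡γ) , _ =
  ≤-trans (γ-minimal H′ (IsDominating-transfer H H′ (λ x∈D → x∈D) (λ _ uv → inj₁ (H⊆H′ uv)) d))
          (≤-reflexive ∣D∣≡γ)

γ-lose-edge : (H H′ : Graph n) (a b : Fin n) →
  (∀ {u v} → adj H u v ≡ true → adj H′ u v ≡ true ⊎ ((u ≡ a × v ≡ b) ⊎ (u ≡ b × v ≡ a))) →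
  γ[ H′ ] ≤ suc γ[ H ]
γ-lose-edge H H′ a b lose with γ-isDominationNumber H
... | (D , d , ∣D∣≡γ) , _ = begin
  γ[ H′ ]           ≤⟨ γ-minimal H′ (IsDominating-transfer H H′ (λ x∈D → x∈p∪q⁺ (inj₁ x∈D)) covered d) ⟩
  ∣ D ∪ ⁅ extra ⁆ ∣ ≤⟨ ∣p∪⁅x⁆∣≤1+∣p∣ D extra ⟩
  suc ∣ D ∣         ≡⟨ cong suc ∣D∣≡γ ⟩
  suc γ[ H ]        ∎
  where
  open ≤-Reasoning

  extra : Fin _
  extra with a ∈? D
  ... | yes _ = b
  ... | no _  = a

  covered : ∀ {u v} → u ∈ D → adj H u v ≡ true → adj H′ u v ≡ true ⊎ v ∈ D ∪ ⁅ extra ⁆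
  covered u∈D uv with lose uv
  ... | inj₁ uv′ = inj₁ uv′
  ... | inj₂ (inj₁ (refl , refl)) with a ∈? D
  ...   | yes _   = inj₂ (x∈p∪q⁺ (inj₂ (x∈⁅x⁆ b)))
  ...   | no a∉D  = contradiction u∈D a∉D
  covered u∈D uv | inj₂ (inj₂ (refl , refl)) with a ∈? D
  ...   | yes a∈D = inj₂ (x∈p∪q⁺ (inj₁ a∈D))
  ...   | no _    = inj₂ (x∈p∪q⁺ (inj₂ (x∈⁅x⁆ a)))

adj-delete-[] : (G : Graph n) (u v : Fin n) → adj (delete G []) u v ≡ adj G u v
adj-delete-[] G u v = ∧-identityʳ (adj G u v)

adj-delete-∷ : (G : Graph n) (a b : Fin n) (F : List (Fin n × Fin n)) {u v : Fin n} →
  adj (delete G F) u v ≡ true →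
  adj (delete G ((a , b) ∷ F)) u v ≡ true ⊎ ((u ≡ a × v ≡ b) ⊎ (u ≡ b × v ≡ a))
adj-delete-∷ G a b F {u} {v} uv with a ≟ u | b ≟ v | a ≟ v | b ≟ u
... | yes refl | yes refl | _        | _        = inj₂ (inj₁ (refl , refl))
... | _        | _        | yes refl | yes refl = inj₂ (inj₂ (refl , refl))
... | no _     | _        | no _     | _        = inj₁ uv
... | no _     | _        | yes _    | no _     = inj₁ uv
... | yes _    | no _     | no _     | _        = inj₁ uv
... | yes _    | no _     | yes _    | no _     = inj₁ uv

γ-delete-∷ : (G : Graph n) (a b : Fin n) (F : List (Fin n × Fin n)) →
  γ[ delete G ((a , b) ∷ F) ] ≤ suc γ[ delete G F ]
γ-delete-∷ G a b F = γ-lose-edge (delete G F) (delete G ((a , b) ∷ F)) a b (adj-delete-∷ G a b F)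

γ-delete≤γ+length : (G : Graph n) (F : List (Fin n × Fin n)) → γ[ delete G F ] ≤ γ[ G ] + length F
γ-delete≤γ+length G [] =
  subst (γ[ delete G [] ] ≤_) (sym (+-identityʳ γ[ G ]))
        (γ-antimono G (delete G []) λ {u} {v} uv → trans (adj-delete-[] G u v) uv)
γ-delete≤γ+length G ((a , b) ∷ F) =
  subst (γ[ delete G ((a , b) ∷ F) ] ≤_) (sym (+-suc γ[ G ] (length F)))
        (≤-trans (γ-delete-∷ G a b F) (s≤s (γ-delete≤γ+length G F)))

occurs₁-∈ : {F : List (Fin n × Fin n)} {u v : Fin n} → (u , v) ∈ₗ F → occurs₁ F u v ≡ true
occurs₁-∈ {u = u} {v} (here refl) with u ≟ u | v ≟ v
... | yes _   | yes _   = refl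
... | no u≢u  | _       = contradiction refl u≢u
... | yes _   | no v≢v  = contradiction refl v≢v
occurs₁-∈ {F = (a , b) ∷ F} {u} {v} (there uv∈F) =
  trans (cong (⌊ a ≟ u ⌋ ∧ ⌊ b ≟ v ⌋ ∨_) (occurs₁-∈ uv∈F)) (∨-zeroʳ _)

module _ (G : Graph n) where

  IsEdge : Fin n × Fin n → Set
  IsEdge (u , v) = (u Data.Fin.< v) × adj G u v ≡ true

  isEdge? : ∀ e → Dec (IsEdge e)
  isEdge? (u , v) = (u Fin.<? v) ×-dec (adj G u v Bool.≟ true)

  edges : List (Fin n × Fin n)
  edges = filter isEdge? (cartesianProduct (allFin n) (allFin n))

  edges-isEdgeSet : IsEdgeSet G edges
  edges-isEdgeSet =
    Unique.filter⁺ isEdge? (Unique.cartesianProduct⁺ (Unique.allFin⁺ n) (Unique.allFin⁺ n)) ,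
    All.map (λ { {u , v} e → e }) (All.all-filter isEdge? (cartesianProduct (allFin n) (allFin n)))

  ∈-edges : ∀ {u v} → IsEdge (u , v) → (u , v) ∈ₗ edges
  ∈-edges {u} {v} = ∈-filter⁺ isEdge? (∈-cartesianProduct⁺ (∈-allFin u) (∈-allFin v))

  delete-edges-edgeless : ∀ u v → adj (delete G edges) u v ≡ false
  delete-edges-edgeless u v with adj G u v in uv
  ... | false = refl
  ... | true with Fin.<-cmp u v
  ...   | tri< u<v _ _ rewrite occurs₁-∈ (∈-edges (u<v , uv)) = refl
  ...   | tri≈ _ refl _ = contradiction (trans (sym uv) (irrefl G u)) λ ()
  ...   | tri> _ _ v<u rewrite occurs₁-∈ (∈-edges (v<u , trans (Graph.sym G v u) uv))
                       | ∨-zeroʳ (occurs₁ edges u v) = refl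

edgeless-dominating⇒⊤⊆ : (H : Graph n) → (∀ u v → adj H u v ≡ false) →
  {D : Subset n} → IsDominating H D → ⊤ ⊆ D
edgeless-dominating⇒⊤⊆ H edgeless d {v} _ with d v
... | inj₁ v∈D          = v∈D
... | inj₂ (u , _ , uv) = contradiction (trans (sym uv) (edgeless u v)) λ ()

edgeless⇒n≤γ : (H : Graph n) → (∀ u v → adj H u v ≡ false) → n ≤ γ[ H ]
edgeless⇒n≤γ {n} H edgeless with γ-isDominationNumber H
... | (D , d , ∣D∣≡γ) , _ =
  subst₂ _≤_ (∣⊤∣≡n n) ∣D∣≡γ (p⊆q⇒∣p∣≤∣q∣ (edgeless-dominating⇒⊤⊆ H edgeless d))

drop-intermediate-value : {A : Set} (f : List A → ℕ) → (∀ x xs → f (x ∷ xs) ≤ suc (f xs)) →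
  ∀ xs {t} → f [] ≤ t → t ≤ f xs → ∃[ j ] f (drop j xs) ≡ t
drop-intermediate-value f step [] lo hi = 0 , ≤-antisym lo hi
drop-intermediate-value f step (x ∷ xs) {t} lo hi with f (x ∷ xs) Data.Nat.≟ t
... | yes reached = 0 , reached
... | no missed =
  let j , reached = drop-intermediate-value f step xs lo (s≤s⁻¹ (≤-trans (≤∧≢⇒< hi (≢-sym missed)) (step x xs)))
  in suc j , reached

proposition2 : ∀ (n : ℕ) (G : Graph n) (k : ℕ) → 1 ≤ k →
    ∀ (γ : ℕ) → IsDominationNumber G γ → γ + k ≤ n →
    (∃[ F ] (IsEdgeSet G F × IsDominationNumber (delete G F) (γ + k))) ×
    (∀ F → IsEdgeSet G F → IsDominationNumber (delete G F) (γ + k) → k ≤ length F)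
proposition2 n G k _ γ isγ γ+k≤n = attained , lower-bound
  where
  open ≤-Reasoning

  γ≡γ[G] : γ ≡ γ[ G ]
  γ≡γ[G] = IsDominationNumber⇒≡γ G isγ

  γ[G-F]≤γ+∣F∣ : ∀ F → γ[ delete G F ] ≤ γ + length F
  γ[G-F]≤γ+∣F∣ F = subst (λ g → γ[ delete G F ] ≤ g + length F) (sym γ≡γ[G]) (γ-delete≤γ+length G F)

  lower-bound : ∀ F → IsEdgeSet G F → IsDominationNumber (delete G F) (γ + k) → k ≤ length F
  lower-bound F _ γ[G-F]-is-γ+k = +-cancelˡ-≤ γ k (length F) (begin
    γ + k              ≡⟨ IsDominationNumber⇒≡γ (delete G F) γ[G-F]-is-γ+k ⟩
    γ[ delete G F ]    ≤⟨ γ[G-F]≤γ+∣F∣ F ⟩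
    γ + length F       ∎)

  attained : ∃[ F ] (IsEdgeSet G F × IsDominationNumber (delete G F) (γ + k))
  attained with drop-intermediate-value (λ F → γ[ delete G F ]) (λ (a , b) F → γ-delete-∷ G a b F)
                  (edges G) (≤-trans (γ[G-F]≤γ+∣F∣ []) (+-monoʳ-≤ γ z≤n))
                  (≤-trans γ+k≤n (edgeless⇒n≤γ _ (delete-edges-edgeless G)))
  ... | j , reached =
    drop j (edges G) ,
    (Unique.drop⁺ j (proj₁ (edges-isEdgeSet G)) , All.drop⁺ j (proj₂ (edges-isEdgeSet G))) ,
    subst (IsDominationNumber (delete G (drop j (edges G)))) reached (γ-isDominationNumber _)
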